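{- Let $k,n$ be positive integers with $n>1$, let $d=2k$, $c\in\mathbb{Q}$, and $f_{d,c}(x)=x^d+c$. Suppose $X_1/Z$ and $X_2/Z=f_{d,c}(X_1/Z)$ are rational periodic points of exact period $n$ of $f_{d,c}$, with $c=C/Z^d$, where $X_1,X_2,C,Z$ are integers and $X_1/Z$, $X_2/Z$, $C/Z^d$ are in lowest terms. Then $\gcd(X_1,X_2)=1$. Moreover, if $n=2$, then: (a) $X_1^k+X_2^k=\delta Z_1^{2k-1}$ for some $Z_1\in\mathbb{Z}$ and $\delta\in\{1,2\}$; (b) if $k$ is odd, then $X_1^k+X_2^k=Z_1^{2k-1}$ for some $Z_1\in\mathbb{Z}$.
   Context: A point $P$ is periodic of exact period $n$ for $f$ if $f^n(P)=P$ and $f^m(P)\neq P$ for $0<m<n$, where $f^m$ denotes the $m$-th iterate. -}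

module Defs where

open import Data.Nat using (ℕ; zero; suc; _<_)
open import Data.Rational using (ℚ; 1ℚ; _*_; _+_)
open import Relation.Binary.PropositionalEquality using (_≡_; _≢_)
open import Data.Product using (_×_)

_^ℚ_ : ℚ → ℕ → ℚ
x ^ℚ zero  = 1ℚ
x ^ℚ suc m = x * (x ^ℚ m)

iterate : {A : Set} → (A → A) → ℕ → A → A
iterate f zero    x = x
iterate f (suc m) x = f (iterate f m x)

f : ℕ → ℚ → ℚ → ℚ
f d c x = (x ^ℚ d) + c

ExactPeriod : {A : Set} → (A → A) → ℕ → A → Set
ExactPeriod g n P = (iterate g n P ≡ P) × (∀ m → 0 < m → m < n → iterate g m P ≢ P)

{-# OPTIONS --safe #-}
module Submission where

-- If g = gcd(X₁, X₂) ≠ 1, then g is coprime to Z, so x₁, x₂ and c = x₂ - x₁ ^ d are divisible by g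
-- in the ring of fractions with denominators coprime to g, and hence so is every orbit point.
-- As f a - f b = (a - b) (a ^ (d - 1) + ⋯ + b ^ (d - 1)) with the second factor divisible by g,
-- the difference of the i-th and (i + 1)-st orbit points is divisible by g ^ (i + 1); by periodicity
-- x₁ - x₂ is then divisible by every power of g, so x₁ = x₂, contradicting n > 1.
-- For n = 2, subtracting f x₁ = x₂ from f x₂ = x₁ and clearing denominators gives
-- Z ^ (2k - 1) = - A B with B = X₁ ^ k + X₂ ^ k and A = (X₂ ^ k - X₁ ^ k) / (X₂ - X₁). Here gcd(A, B) ∣ 2,
-- and 2k - 1 is odd, so B is a (2k - 1)-th power as soon as A or B is odd. Otherwise X₁ and X₂ are odd;
-- then A ≡ k mod 2, and for even k also B ≡ 2 mod 4, so that B / 2 is a (2k - 1)-th power.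

open import Defs
open import Data.Nat using (ℕ; _≤_; _<_; _∸_; _%_) renaming (_*_ to _*ℕ_)
open import Data.Integer using (ℤ; +_; 1ℤ; _+_; _*_; _^_)
open import Data.Integer.GCD using (gcd)
open import Data.Rational using (ℚ; ↥_; ↧_)
open import Data.Product using (_×_; ∃-syntax)
open import Data.Sum using (_⊎_)
open import Relation.Binary.PropositionalEquality using (_≡_)

open import Data.Empty using (⊥-elim)
open import Data.Nat as ℕ using (zero; suc; s≤s; z≤n; NonZero)
import Data.Nat.Properties as ℕP
open import Data.Nat.Divisibility using (_∣_; divides; ∣-trans)
import Data.Nat.Divisibility as ℕD
import Data.Nat.DivMod as ℕDM
open import Data.Nat.Coprimality as Cop using (Coprime; coprime-divisor)
import Data.Nat.GCD as ℕG
open import Data.Integer as ℤ using (_-_; -_; ∣_∣)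
import Data.Integer.Properties as ℤP
import Data.Integer.Divisibility.Signed as ℤD
import Data.Integer.DivMod as ℤDM
open import Data.Integer.Tactic.RingSolver using (solve-∀)
import Data.Rational as ℚ
import Data.Rational.Properties as ℚP
import Data.Rational.Unnormalised as ℚᵘ
import Data.Rational.Unnormalised.Properties as ℚᵘP
open import Data.Rational.Solver using (module +-*-Solver)
open +-*-Solver using (_:=_; _:+_; _:*_; _:-_; solve)
open import Data.Product using (_,_; proj₁; proj₂; map₂)
open import Data.Sum using (inj₁; inj₂)
open import Relation.Binary.PropositionalEquality
  using (refl; sym; trans; cong; cong₂; subst; subst₂; _≢_; module ≡-Reasoning)
open import Relation.Nullary using (¬_; yes; no; contradiction)
open import Algebra.Bundles using (CommutativeMonoid)
import Algebra.Properties.CommutativeSemigroup as CommSemigroupProperties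
open import Algebra.Properties.Ring ℚP.+-*-ring using ([y-z]x≈yx-zx)

fromℤ : ℤ → ℚ
fromℤ z = ℚ.mkℚ z 0 (Cop.sym (Cop.1-coprimeTo ∣ z ∣))

fromℤ-+ : ∀ a b → fromℤ (a + b) ≡ fromℤ a ℚ.+ fromℤ b
fromℤ-+ a b = ℚP.toℚᵘ-injective
  (ℚᵘP.≃-trans (ℚᵘ.*≡* (identity a b)) (ℚᵘP.≃-sym (ℚP.toℚᵘ-homo-+ (fromℤ a) (fromℤ b))))
  where
  identity : ∀ a b → (a + b) * + 1 ≡ (a * + 1 + b * + 1) * + 1
  identity = solve-∀

fromℤ-* : ∀ a b → fromℤ (a * b) ≡ fromℤ a ℚ.* fromℤ b
fromℤ-* a b = ℚP.toℚᵘ-injective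
  (ℚᵘP.≃-trans (ℚᵘ.*≡* refl) (ℚᵘP.≃-sym (ℚP.toℚᵘ-homo-* (fromℤ a) (fromℤ b))))

fromℤ-neg : ∀ a → fromℤ (- a) ≡ ℚ.- fromℤ a
fromℤ-neg (+ zero)  = refl
fromℤ-neg (+ suc n) = refl
fromℤ-neg ℤ.-[1+ n ] = refl

fromℤ-minus : ∀ a b → fromℤ (a - b) ≡ fromℤ a ℚ.- fromℤ b
fromℤ-minus a b = trans (fromℤ-+ a (- b)) (cong (fromℤ a ℚ.+_) (fromℤ-neg b))

fromℤ-^ : ∀ a m → fromℤ (a ^ m) ≡ fromℤ a ^ℚ m
fromℤ-^ a zero    = refl
fromℤ-^ a (suc m) = trans (fromℤ-* a (a ^ m)) (cong (fromℤ a ℚ.*_) (fromℤ-^ a m))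

*-↧≡↥ : ∀ x → x ℚ.* fromℤ (↧ x) ≡ fromℤ (↥ x)
*-↧≡↥ x@record{} = ℚP.toℚᵘ-injective
  (ℚᵘP.≃-trans (ℚP.toℚᵘ-homo-* x (fromℤ (↧ x))) (ℚᵘ.*≡* (identity (↥ x) (ℚ.↧ₙ x))))
  where
  identity : ∀ a n → (a * + n) * + 1 ≡ a * + (n ℕ.* 1)
  identity a n rewrite ℕP.*-identityʳ n = ℤP.*-identityʳ (a * + n)

coprime-*ˡ : ∀ {a b c} → Coprime a c → Coprime b c → Coprime (a ℕ.* b) c
coprime-*ˡ {a} coprime-ac coprime-bc (d∣ab , d∣c) =
  coprime-bc (coprime-divisor coprime-da d∣ab , d∣c)
  where
  coprime-da : Coprime _ a
  coprime-da (e∣d , e∣a) = coprime-ac (e∣a , ∣-trans e∣d d∣c)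

coprime-^ˡ : ∀ {a b} → Coprime a b → ∀ e → Coprime (a ℕ.^ e) b
coprime-^ˡ {b = b} _ zero    = Cop.1-coprimeTo b
coprime-^ˡ         c (suc e) = coprime-*ˡ c (coprime-^ˡ c e)

^-distribʳ-* : ∀ a b e → (a ℕ.* b) ℕ.^ e ≡ a ℕ.^ e ℕ.* b ℕ.^ e
^-distribʳ-* a b zero    = refl
^-distribʳ-* a b (suc e) =
  trans (cong ((a ℕ.* b) ℕ.*_) (^-distribʳ-* a b e))
        (CommSemigroupProperties.interchange ℕP.*-commutativeSemigroup a b (a ℕ.^ e) (b ℕ.^ e))

n<m^n : ∀ {m} → 1 < m → ∀ n → n < m ℕ.^ n
n<m^n _ zero = s≤s z≤n
n<m^n {m} 1<m@(s≤s (s≤s _)) (suc n) = begin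
  suc (suc n)           ≤⟨ ℕP.+-monoʳ-≤ 1 (n<m^n 1<m n) ⟩
  1 ℕ.+ m ℕ.^ n         ≤⟨ ℕP.+-monoˡ-≤ (m ℕ.^ n) (ℕP.m^n>0 m n) ⟩
  m ℕ.^ n ℕ.+ m ℕ.^ n   ≤⟨ ℕP.+-monoʳ-≤ (m ℕ.^ n) (ℕP.m≤m+n (m ℕ.^ n) _) ⟩
  m ℕ.^ suc n           ∎
  where open ℕP.≤-Reasoning

∣^∣ : ∀ i m → ∣ i ^ m ∣ ≡ ∣ i ∣ ℕ.^ m
∣^∣ i zero    = refl
∣^∣ i (suc m) = trans (ℤP.abs-* i (i ^ m)) (cong (∣ i ∣ ℕ.*_) (∣^∣ i m))

pos-^ : ∀ t e → + (t ℕ.^ e) ≡ (+ t) ^ e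
pos-^ t zero    = refl
pos-^ t (suc e) = trans (ℤP.pos-* t (t ℕ.^ e)) (cong (+ t *_) (pos-^ t e))

ℚ-*-interchange : ∀ w x y z → (w ℚ.* x) ℚ.* (y ℚ.* z) ≡ (w ℚ.* y) ℚ.* (x ℚ.* z)
ℚ-*-interchange = CommSemigroupProperties.interchange
  (CommutativeMonoid.commutativeSemigroup ℚP.*-1-commutativeMonoid)

^ℚ-distribʳ-* : ∀ x y e → (x ℚ.* y) ^ℚ e ≡ x ^ℚ e ℚ.* y ^ℚ e
^ℚ-distribʳ-* x y zero    = refl
^ℚ-distribʳ-* x y (suc e) =
  trans (cong ((x ℚ.* y) ℚ.*_) (^ℚ-distribʳ-* x y e)) (ℚ-*-interchange x y (x ^ℚ e) (y ^ℚ e))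

geometricℚ : ℕ → ℚ → ℚ → ℚ
geometricℚ zero    a b = ℚ.0ℚ
geometricℚ (suc j) a b = a ^ℚ j ℚ.+ b ℚ.* geometricℚ j a b

^ℚ-difference : ∀ j a b → a ^ℚ j ℚ.- b ^ℚ j ≡ (a ℚ.- b) ℚ.* geometricℚ j a b
^ℚ-difference zero    a b = sym (ℚP.*-zeroʳ (a ℚ.- b))
^ℚ-difference (suc j) a b = begin
  a ℚ.* a ^ℚ j ℚ.- b ℚ.* b ^ℚ j
    ≡⟨ solve 4 (λ a b A B → a :* A :- b :* B := (a :- b) :* A :+ b :* (A :- B))
             refl a b (a ^ℚ j) (b ^ℚ j) ⟩
  (a ℚ.- b) ℚ.* a ^ℚ j ℚ.+ b ℚ.* (a ^ℚ j ℚ.- b ^ℚ j)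
    ≡⟨ cong (λ t → (a ℚ.- b) ℚ.* a ^ℚ j ℚ.+ b ℚ.* t) (^ℚ-difference j a b) ⟩
  (a ℚ.- b) ℚ.* a ^ℚ j ℚ.+ b ℚ.* ((a ℚ.- b) ℚ.* geometricℚ j a b)
    ≡⟨ solve 4 (λ a b A T → (a :- b) :* A :+ b :* ((a :- b) :* T) := (a :- b) :* (A :+ b :* T))
             refl a b (a ^ℚ j) (geometricℚ j a b) ⟩
  (a ℚ.- b) ℚ.* geometricℚ (suc j) a b ∎
  where open ≡-Reasoning

geometric : ℕ → ℤ → ℤ → ℤ
geometric zero    a b = + 0
geometric (suc j) a b = a ^ j + b * geometric j a b

^-difference : ∀ j a b → a ^ j - b ^ j ≡ (a - b) * geometric j a b
^-difference zero    a b = sym (ℤP.*-zeroʳ (a - b))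
^-difference (suc j) a b = begin
  a * a ^ j - b * b ^ j                           ≡⟨ split a b (a ^ j) (b ^ j) ⟩
  (a - b) * a ^ j + b * (a ^ j - b ^ j)           ≡⟨ cong (λ t → (a - b) * a ^ j + b * t) (^-difference j a b) ⟩
  (a - b) * a ^ j + b * ((a - b) * geometric j a b) ≡⟨ collect a b (a ^ j) (geometric j a b) ⟩
  (a - b) * geometric (suc j) a b                 ∎
  where
  open ≡-Reasoning
  split : ∀ a b A B → a * A - b * B ≡ (a - b) * A + b * (A - B)
  split = solve-∀
  collect : ∀ a b A T → (a - b) * A + b * ((a - b) * T) ≡ (a - b) * (A + b * T)
  collect = solve-∀

-- g ^ m divides q in the ring of fractions whose denominators are coprime to g
record DivisibleByPow (g m : ℕ) (q : ℚ) : Set where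
  constructor divisible
  field
    numerator denominator : ℤ
    denominator-coprime   : Coprime ∣ denominator ∣ g
    equation              : q ℚ.* fromℤ denominator ≡ fromℤ ((+ g) ^ m * numerator)

module _ {g : ℕ} where

  private
    G : ℤ
    G = + g

    coprime-denominators : ∀ V W → Coprime ∣ V ∣ g → Coprime ∣ W ∣ g → Coprime ∣ V * W ∣ g
    coprime-denominators V W cV cW = subst (λ t → Coprime t g) (sym (ℤP.abs-* V W)) (coprime-*ˡ cV cW)

  divisible-* : ∀ {m n p q} → DivisibleByPow g m p → DivisibleByPow g n q →
                DivisibleByPow g (m ℕ.+ n) (p ℚ.* q)
  divisible-* {m} {n} {p} {q} (divisible Y₁ W₁ c₁ e₁) (divisible Y₂ W₂ c₂ e₂) =
    divisible (Y₁ * Y₂) (W₁ * W₂) (coprime-denominators W₁ W₂ c₁ c₂) (begin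
      (p ℚ.* q) ℚ.* fromℤ (W₁ * W₂)             ≡⟨ cong ((p ℚ.* q) ℚ.*_) (fromℤ-* W₁ W₂) ⟩
      (p ℚ.* q) ℚ.* (fromℤ W₁ ℚ.* fromℤ W₂)     ≡⟨ ℚ-*-interchange p q (fromℤ W₁) (fromℤ W₂) ⟩
      (p ℚ.* fromℤ W₁) ℚ.* (q ℚ.* fromℤ W₂)     ≡⟨ cong₂ ℚ._*_ e₁ e₂ ⟩
      fromℤ (G ^ m * Y₁) ℚ.* fromℤ (G ^ n * Y₂) ≡⟨ sym (fromℤ-* (G ^ m * Y₁) (G ^ n * Y₂)) ⟩
      fromℤ (G ^ m * Y₁ * (G ^ n * Y₂))         ≡⟨ cong fromℤ (regroup (G ^ m) (G ^ n) Y₁ Y₂) ⟩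
      fromℤ (G ^ m * G ^ n * (Y₁ * Y₂))         ≡⟨ cong (λ t → fromℤ (t * (Y₁ * Y₂))) (ℤP.^-distribˡ-+-* G m n) ⟨
      fromℤ (G ^ (m ℕ.+ n) * (Y₁ * Y₂))         ∎)
    where
    open ≡-Reasoning
    regroup : ∀ a b y₁ y₂ → a * y₁ * (b * y₂) ≡ a * b * (y₁ * y₂)
    regroup = solve-∀

  divisible-+ : ∀ {m p q} → DivisibleByPow g m p → DivisibleByPow g m q → DivisibleByPow g m (p ℚ.+ q)
  divisible-+ {m} {p} {q} (divisible Y₁ W₁ c₁ e₁) (divisible Y₂ W₂ c₂ e₂) =
    divisible (Y₁ * W₂ + Y₂ * W₁) (W₁ * W₂) (coprime-denominators W₁ W₂ c₁ c₂) (begin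
      (p ℚ.+ q) ℚ.* fromℤ (W₁ * W₂)
        ≡⟨ cong ((p ℚ.+ q) ℚ.*_) (fromℤ-* W₁ W₂) ⟩
      (p ℚ.+ q) ℚ.* (fromℤ W₁ ℚ.* fromℤ W₂)
        ≡⟨ solve 4 (λ p q a b → (p :+ q) :* (a :* b) := (p :* a) :* b :+ (q :* b) :* a)
                 refl p q (fromℤ W₁) (fromℤ W₂) ⟩
      (p ℚ.* fromℤ W₁) ℚ.* fromℤ W₂ ℚ.+ (q ℚ.* fromℤ W₂) ℚ.* fromℤ W₁
        ≡⟨ cong₂ (λ u v → u ℚ.* fromℤ W₂ ℚ.+ v ℚ.* fromℤ W₁) e₁ e₂ ⟩
      fromℤ (G ^ m * Y₁) ℚ.* fromℤ W₂ ℚ.+ fromℤ (G ^ m * Y₂) ℚ.* fromℤ W₁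
        ≡⟨ sym (cong₂ ℚ._+_ (fromℤ-* (G ^ m * Y₁) W₂) (fromℤ-* (G ^ m * Y₂) W₁)) ⟩
      fromℤ (G ^ m * Y₁ * W₂) ℚ.+ fromℤ (G ^ m * Y₂ * W₁)
        ≡⟨ sym (fromℤ-+ (G ^ m * Y₁ * W₂) (G ^ m * Y₂ * W₁)) ⟩
      fromℤ (G ^ m * Y₁ * W₂ + G ^ m * Y₂ * W₁)
        ≡⟨ cong fromℤ (factor (G ^ m) Y₁ Y₂ W₁ W₂) ⟩
      fromℤ (G ^ m * (Y₁ * W₂ + Y₂ * W₁)) ∎)
    where
    open ≡-Reasoning
    factor : ∀ a y₁ y₂ w₁ w₂ → a * y₁ * w₂ + a * y₂ * w₁ ≡ a * (y₁ * w₂ + y₂ * w₁)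
    factor = solve-∀

  divisible-neg : ∀ {m p} → DivisibleByPow g m p → DivisibleByPow g m (ℚ.- p)
  divisible-neg {m} {p} (divisible Y W c e) = divisible (- Y) W c (begin
    (ℚ.- p) ℚ.* fromℤ W     ≡⟨ ℚP.neg-distribˡ-* p (fromℤ W) ⟨
    ℚ.- (p ℚ.* fromℤ W)     ≡⟨ cong ℚ.-_ e ⟩
    ℚ.- fromℤ (G ^ m * Y)   ≡⟨ sym (fromℤ-neg (G ^ m * Y)) ⟩
    fromℤ (- (G ^ m * Y))   ≡⟨ cong fromℤ (ℤP.neg-distribʳ-* (G ^ m) Y) ⟩
    fromℤ (G ^ m * (- Y))   ∎)
    where open ≡-Reasoning

  divisible-minus : ∀ {m p q} → DivisibleByPow g m p → DivisibleByPow g m q → DivisibleByPow g m (p ℚ.- q)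
  divisible-minus dp dq = divisible-+ dp (divisible-neg dq)

  divisible-≤ : ∀ {m n q} → m ≤ n → DivisibleByPow g n q → DivisibleByPow g m q
  divisible-≤ {m} {n} m≤n (divisible Y W c e) =
    divisible (G ^ (n ∸ m) * Y) W c (trans e (cong fromℤ (begin
    G ^ n * Y                   ≡⟨ cong (λ t → G ^ t * Y) (sym (ℕP.m+[n∸m]≡n m≤n)) ⟩
    G ^ (m ℕ.+ (n ∸ m)) * Y     ≡⟨ cong (_* Y) (ℤP.^-distribˡ-+-* G m (n ∸ m)) ⟩
    G ^ m * G ^ (n ∸ m) * Y     ≡⟨ ℤP.*-assoc (G ^ m) (G ^ (n ∸ m)) Y ⟩
    G ^ m * (G ^ (n ∸ m) * Y)   ∎)))
    where open ≡-Reasoning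

  divisible-fromℤ : ∀ z → DivisibleByPow g 0 (fromℤ z)
  divisible-fromℤ z = divisible z 1ℤ (Cop.1-coprimeTo g)
    (trans (sym (fromℤ-* z 1ℤ)) (cong fromℤ (ℤP.*-comm z 1ℤ)))

  divisible-^ : ∀ {p} → DivisibleByPow g 0 p → ∀ j → DivisibleByPow g 0 (p ^ℚ j)
  divisible-^ dp zero    = divisible-fromℤ 1ℤ
  divisible-^ dp (suc j) = divisible-* dp (divisible-^ dp j)

  divisible-^⁺ : ∀ {p e} → 0 < e → DivisibleByPow g 1 p → DivisibleByPow g 1 (p ^ℚ e)
  divisible-^⁺ {e = suc j} (s≤s z≤n) dp = divisible-* dp (divisible-^ (divisible-≤ z≤n dp) j)

  divisible-geometricℚ : ∀ {a b} → DivisibleByPow g 0 a → DivisibleByPow g 0 b →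
                         ∀ j → DivisibleByPow g 0 (geometricℚ j a b)
  divisible-geometricℚ da db zero    = divisible-fromℤ (+ 0)
  divisible-geometricℚ da db (suc j) =
    divisible-+ (divisible-^ da j) (divisible-* db (divisible-geometricℚ da db j))

  divisible-geometricℚ⁺ : ∀ {a b d} → 1 < d → DivisibleByPow g 1 a → DivisibleByPow g 1 b →
                          DivisibleByPow g 1 (geometricℚ d a b)
  divisible-geometricℚ⁺ {d = suc (suc j)} (s≤s (s≤s z≤n)) da db =
    divisible-+ (divisible-^⁺ {e = suc j} (s≤s z≤n) da)
                (divisible-* db (divisible-geometricℚ (divisible-≤ z≤n da) (divisible-≤ z≤n db) (suc j)))

  divisible-fromℤ⇒∣ : ∀ {m X} → DivisibleByPow g m (fromℤ X) → g ℕ.^ m ∣ ∣ X ∣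
  divisible-fromℤ⇒∣ {m} {X} (divisible Y W c e) =
    coprime-divisor (coprime-^ˡ (Cop.sym c) m) (divides ∣ Y ∣ (begin
      ∣ W ∣ ℕ.* ∣ X ∣           ≡⟨ sym (ℤP.abs-* W X) ⟩
      ∣ W * X ∣                 ≡⟨ cong ∣_∣ (trans (ℤP.*-comm W X) integral) ⟩
      ∣ G ^ m * Y ∣             ≡⟨ ℤP.abs-* (G ^ m) Y ⟩
      ∣ G ^ m ∣ ℕ.* ∣ Y ∣       ≡⟨ cong (ℕ._* ∣ Y ∣) (∣^∣ G m) ⟩
      g ℕ.^ m ℕ.* ∣ Y ∣         ≡⟨ ℕP.*-comm (g ℕ.^ m) ∣ Y ∣ ⟩
      ∣ Y ∣ ℕ.* g ℕ.^ m         ∎))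
    where
    open ≡-Reasoning
    integral : X * W ≡ G ^ m * Y
    integral = cong ↥_ (trans (fromℤ-* X W) e)

  divisible-fraction : ∀ {x X Z} → x ℚ.* fromℤ Z ≡ fromℤ X → g ∣ ∣ X ∣ → Coprime ∣ Z ∣ g →
                       DivisibleByPow g 1 x
  divisible-fraction {x} {X} {Z} xZ≡X g∣X cZ with ℤD.∣ᵤ⇒∣ {G} {X} g∣X
  ... | ℤD.divides Q X≡QG = divisible Q Z cZ (trans xZ≡X (cong fromℤ (trans X≡QG (swap Q G))))
    where
    swap : ∀ q h → q * h ≡ h * 1ℤ * q
    swap = solve-∀

iterate-+ : ∀ {A : Set} (F : A → A) m n x → iterate F (m ℕ.+ n) x ≡ iterate F m (iterate F n x)
iterate-+ F zero    n x = refl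
iterate-+ F (suc m) n x = cong F (iterate-+ F m n x)

iterate-periodic : ∀ {A : Set} (F : A → A) {n x} → iterate F n x ≡ x → ∀ m → iterate F (m ℕ.* n) x ≡ x
iterate-periodic F         periodic zero    = refl
iterate-periodic F {n} {x} periodic (suc m) =
  trans (iterate-+ F n (m ℕ.* n) x) (trans (cong (iterate F n) (iterate-periodic F periodic m)) periodic)

f-difference : ∀ d c a b → f d c a ℚ.- f d c b ≡ a ^ℚ d ℚ.- b ^ℚ d
f-difference d c a b = solve 3 (λ A B c → (A :+ c) :- (B :+ c) := A :- B) refl (a ^ℚ d) (b ^ℚ d) c

f-difference-factor : ∀ d c a b → f d c a ℚ.- f d c b ≡ geometricℚ d a b ℚ.* (a ℚ.- b)
f-difference-factor d c a b =
  trans (f-difference d c a b) (trans (^ℚ-difference d a b) (ℚP.*-comm (a ℚ.- b) (geometricℚ d a b)))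

module _ {g d : ℕ} (1<d : 1 < d) {c : ℚ} (g∣c : DivisibleByPow g 1 c) where

  divisible-f : ∀ {y} → DivisibleByPow g 1 y → DivisibleByPow g 1 (f d c y)
  divisible-f dy = divisible-+ (divisible-^⁺ (ℕP.<-trans (s≤s z≤n) 1<d) dy) g∣c

  module _ {x : ℚ} (g∣x : DivisibleByPow g 1 x) where

    divisible-orbit : ∀ i → DivisibleByPow g 1 (iterate (f d c) i x)
    divisible-orbit zero    = g∣x
    divisible-orbit (suc i) = divisible-f (divisible-orbit i)

    divisible-orbit-step : ∀ i → DivisibleByPow g (suc i) (iterate (f d c) i x ℚ.- iterate (f d c) (suc i) x)
    divisible-orbit-step zero    = divisible-minus (divisible-orbit 0) (divisible-orbit 1)
    divisible-orbit-step (suc i) = subst (DivisibleByPow g (suc (suc i)))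
      (sym (f-difference-factor d c (iterate (f d c) i x) (iterate (f d c) (suc i) x)))
      (divisible-* (divisible-geometricℚ⁺ 1<d (divisible-orbit i) (divisible-orbit (suc i)))
                   (divisible-orbit-step i))

    divisible-periodic-step : ∀ {n} → 0 < n → iterate (f d c) n x ≡ x →
                              ∀ m → DivisibleByPow g m (x ℚ.- f d c x)
    divisible-periodic-step {n} 0<n periodic m =
      subst (λ y → DivisibleByPow g m (y ℚ.- f d c y)) (iterate-periodic (f d c) periodic m)
        (divisible-≤ (ℕP.≤-trans (ℕP.m≤m*n m n {{ℕ.>-nonZero 0<n}}) (ℕP.n≤1+n (m ℕ.* n)))
                     (divisible-orbit-step (m ℕ.* n)))

∣-all-powers⇒≡0 : ∀ {g N} → g ≢ 1 → (∀ m → g ℕ.^ m ∣ N) → N ≡ 0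
∣-all-powers⇒≡0 {zero}                g≢1 ∣N = ℕD.0∣⇒≡0 (∣N 1)
∣-all-powers⇒≡0 {suc zero}            g≢1 ∣N = ⊥-elim (g≢1 refl)
∣-all-powers⇒≡0 {suc (suc g)} {zero}  g≢1 ∣N = refl
∣-all-powers⇒≡0 {suc (suc g)} {suc N} g≢1 ∣N =
  ⊥-elim (ℕP.<⇒≱ (n<m^n (s≤s (s≤s z≤n)) (suc N)) (ℕD.∣⇒≤ (∣N (suc N))))

↥↧-coprime : ∀ x {X Z} → ↥ x ≡ X → ↧ x ≡ Z → Coprime ∣ X ∣ ∣ Z ∣
↥↧-coprime (ℚ.mkℚ _ _ coprime) refl refl = Cop.recompute coprime

common-denominator-injective : ∀ {x₁ x₂ X₁ X₂ Z} →
  ↥ x₁ ≡ X₁ → ↧ x₁ ≡ Z → ↥ x₂ ≡ X₂ → ↧ x₂ ≡ Z → X₁ ≡ X₂ → x₁ ≡ x₂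
common-denominator-injective refl ↧x₁ refl ↧x₂ X₁≡X₂ =
  ℚP.≃⇒≡ (ℚ.*≡* (cong₂ _*_ X₁≡X₂ (trans ↧x₂ (sym ↧x₁))))

*-denominator : ∀ x {X Z} → ↥ x ≡ X → ↧ x ≡ Z → x ℚ.* fromℤ Z ≡ fromℤ X
*-denominator x refl refl = *-↧≡↥ x

difference-*-denominator : ∀ x₁ x₂ {X₁ X₂ Z} →
  x₁ ℚ.* fromℤ Z ≡ fromℤ X₁ → x₂ ℚ.* fromℤ Z ≡ fromℤ X₂ → (x₁ ℚ.- x₂) ℚ.* fromℤ Z ≡ fromℤ (X₁ - X₂)
difference-*-denominator x₁ x₂ {X₁} {X₂} {Z} e₁ e₂ = begin
  (x₁ ℚ.- x₂) ℚ.* fromℤ Z               ≡⟨ [y-z]x≈yx-zx (fromℤ Z) x₁ x₂ ⟩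
  x₁ ℚ.* fromℤ Z ℚ.- x₂ ℚ.* fromℤ Z     ≡⟨ cong₂ ℚ._-_ e₁ e₂ ⟩
  fromℤ X₁ ℚ.- fromℤ X₂                 ≡⟨ sym (fromℤ-minus X₁ X₂) ⟩
  fromℤ (X₁ - X₂)                       ∎
  where open ≡-Reasoning

periodic-numerators-coprime :
  ∀ {d n c x₁ x₂ X₁ X₂ Z} → 1 < d → 0 < n →
  ↥ x₁ ≡ X₁ → ↧ x₁ ≡ Z → ↥ x₂ ≡ X₂ → ↧ x₂ ≡ Z →
  x₂ ≡ f d c x₁ → iterate (f d c) n x₁ ≡ x₁ → X₁ ≢ X₂ → gcd X₁ X₂ ≡ 1ℤ
periodic-numerators-coprime {d} {n} {c} {x₁} {x₂} {X₁} {X₂} {Z}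
                            1<d 0<n ↥x₁ ↧x₁ ↥x₂ ↧x₂ x₂≡fx₁ periodic X₁≢X₂ = gcd≡1
  where
  g : ℕ
  g = ℕG.gcd ∣ X₁ ∣ ∣ X₂ ∣
  Z-coprime-g : Coprime ∣ Z ∣ g
  Z-coprime-g (e∣Z , e∣g) = ↥↧-coprime x₁ ↥x₁ ↧x₁ (∣-trans e∣g (ℕG.gcd[m,n]∣m ∣ X₁ ∣ ∣ X₂ ∣) , e∣Z)
  g∣x₁ : DivisibleByPow g 1 x₁
  g∣x₁ = divisible-fraction (*-denominator x₁ ↥x₁ ↧x₁) (ℕG.gcd[m,n]∣m ∣ X₁ ∣ ∣ X₂ ∣) Z-coprime-g
  g∣x₂ : DivisibleByPow g 1 x₂
  g∣x₂ = divisible-fraction (*-denominator x₂ ↥x₂ ↧x₂) (ℕG.gcd[m,n]∣n ∣ X₁ ∣ ∣ X₂ ∣) Z-coprime-g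
  c≡x₂-x₁^d : c ≡ x₂ ℚ.- x₁ ^ℚ d
  c≡x₂-x₁^d = trans (solve 2 (λ A c → c := (A :+ c) :- A) refl (x₁ ^ℚ d) c)
                    (cong (ℚ._- x₁ ^ℚ d) (sym x₂≡fx₁))
  g∣c : DivisibleByPow g 1 c
  g∣c = subst (DivisibleByPow g 1) (sym c≡x₂-x₁^d)
              (divisible-minus g∣x₂ (divisible-^⁺ (ℕP.<-trans (s≤s z≤n) 1<d) g∣x₁))
  g^m∣X₁-X₂ : ∀ m → g ℕ.^ m ∣ ∣ X₁ - X₂ ∣
  g^m∣X₁-X₂ m = divisible-fromℤ⇒∣ (subst₂ (DivisibleByPow g) (ℕP.+-identityʳ m)
    (difference-*-denominator x₁ x₂ (*-denominator x₁ ↥x₁ ↧x₁) (*-denominator x₂ ↥x₂ ↧x₂))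
    (divisible-* (subst (λ y → DivisibleByPow g m (x₁ ℚ.- y)) (sym x₂≡fx₁)
                   (divisible-periodic-step 1<d g∣c g∣x₁ 0<n periodic m))
                 (divisible-fromℤ Z)))
  X₁≡X₂ : g ≢ 1 → X₁ ≡ X₂
  X₁≡X₂ g≢1 = ℤP.i-j≡0⇒i≡j X₁ X₂ (ℤP.∣i∣≡0⇒i≡0 (∣-all-powers⇒≡0 g≢1 g^m∣X₁-X₂))
  gcd≡1 : gcd X₁ X₂ ≡ 1ℤ
  gcd≡1 with g ℕ.≟ 1
  ... | yes g≡1 = cong +_ g≡1
  ... | no  g≢1 = ⊥-elim (X₁≢X₂ (X₁≡X₂ g≢1))

period-two-numerators :
  ∀ {m c x₁ x₂ X₁ X₂ Z} → x₁ ℚ.* fromℤ Z ≡ fromℤ X₁ → x₂ ℚ.* fromℤ Z ≡ fromℤ X₂ →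
  f (suc m) c x₁ ≡ x₂ → f (suc m) c x₂ ≡ x₁ → (X₁ - X₂) * Z ^ m ≡ X₂ ^ suc m - X₁ ^ suc m
period-two-numerators {m} {c} {x₁} {x₂} {X₁} {X₂} {Z} e₁ e₂ fx₁≡x₂ fx₂≡x₁ = cong ↥_ (begin
  fromℤ ((X₁ - X₂) * Z ^ m)                            ≡⟨ fromℤ-* (X₁ - X₂) (Z ^ m) ⟩
  fromℤ (X₁ - X₂) ℚ.* fromℤ (Z ^ m)
    ≡⟨ cong₂ ℚ._*_ (sym (difference-*-denominator x₁ x₂ e₁ e₂)) (fromℤ-^ Z m) ⟩
  (x₁ ℚ.- x₂) ℚ.* fromℤ Z ℚ.* fromℤ Z ^ℚ m             ≡⟨ ℚP.*-assoc (x₁ ℚ.- x₂) (fromℤ Z) (fromℤ Z ^ℚ m) ⟩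
  (x₁ ℚ.- x₂) ℚ.* Zᵈ                                   ≡⟨ cong (ℚ._* Zᵈ) x₁-x₂ ⟩
  (x₂ ^ℚ suc m ℚ.- x₁ ^ℚ suc m) ℚ.* Zᵈ                 ≡⟨ [y-z]x≈yx-zx Zᵈ (x₂ ^ℚ suc m) (x₁ ^ℚ suc m) ⟩
  x₂ ^ℚ suc m ℚ.* Zᵈ ℚ.- x₁ ^ℚ suc m ℚ.* Zᵈ             ≡⟨ cong₂ ℚ._-_ (clear x₂ e₂) (clear x₁ e₁) ⟩
  fromℤ (X₂ ^ suc m) ℚ.- fromℤ (X₁ ^ suc m)            ≡⟨ sym (fromℤ-minus (X₂ ^ suc m) (X₁ ^ suc m)) ⟩
  fromℤ (X₂ ^ suc m - X₁ ^ suc m)                      ∎)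
  where
  open ≡-Reasoning
  Zᵈ : ℚ
  Zᵈ = fromℤ Z ^ℚ suc m
  x₁-x₂ : x₁ ℚ.- x₂ ≡ x₂ ^ℚ suc m ℚ.- x₁ ^ℚ suc m
  x₁-x₂ = trans (cong₂ ℚ._-_ (sym fx₂≡x₁) (sym fx₁≡x₂)) (f-difference (suc m) c x₂ x₁)
  clear : ∀ x {X} → x ℚ.* fromℤ Z ≡ fromℤ X → x ^ℚ suc m ℚ.* Zᵈ ≡ fromℤ (X ^ suc m)
  clear x {X} e =
    trans (sym (^ℚ-distribʳ-* x (fromℤ Z) (suc m))) (trans (cong (_^ℚ suc m) e) (sym (fromℤ-^ X (suc m))))

-- with t = gcd u w, coprimality turns u / t · v = t ^ r · (w / t) ^ (r + 1) into v = (w / t) ^ (r + 1),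
-- and then u / t = t ^ r
coprime-factor-of-power : ∀ r {u v w} → w ≢ 0 → Coprime u v → u ℕ.* v ≡ w ℕ.^ suc r →
                          ∃[ t ] u ≡ t ℕ.^ suc r
coprime-factor-of-power r {u} {v} {w} w≢0 coprime-uv uv≡w^r+1 =
  t , trans (sym t*u′≡u) (cong (t ℕ.*_) u′≡t^r)
  where
  open ≡-Reasoning
  t : ℕ
  t = ℕG.gcd u w
  instance
    t≢0 : NonZero t
    t≢0 = ℕ.≢-nonZero (ℕG.gcd[m,n]≢0 u w (inj₂ w≢0))
  u′ w′ : ℕ
  u′ = u ℕDM./ t
  w′ = w ℕDM./ t
  t*u′≡u : t ℕ.* u′ ≡ u
  t*u′≡u = ℕDM.m*[n/m]≡n (ℕG.gcd[m,n]∣m u w)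
  t*w′≡w : t ℕ.* w′ ≡ w
  t*w′≡w = ℕDM.m*[n/m]≡n (ℕG.gcd[m,n]∣n u w)
  u′v≡t^r*w′^r+1 : u′ ℕ.* v ≡ t ℕ.^ r ℕ.* w′ ℕ.^ suc r
  u′v≡t^r*w′^r+1 = ℕP.*-cancelˡ-≡ _ _ t (begin
    t ℕ.* (u′ ℕ.* v)                  ≡⟨ sym (ℕP.*-assoc t u′ v) ⟩
    t ℕ.* u′ ℕ.* v                    ≡⟨ cong (ℕ._* v) t*u′≡u ⟩
    u ℕ.* v                           ≡⟨ uv≡w^r+1 ⟩
    w ℕ.^ suc r                       ≡⟨ cong (ℕ._^ suc r) (sym t*w′≡w) ⟩
    (t ℕ.* w′) ℕ.^ suc r              ≡⟨ ^-distribʳ-* t w′ (suc r) ⟩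
    t ℕ.^ suc r ℕ.* w′ ℕ.^ suc r      ≡⟨ ℕP.*-assoc t (t ℕ.^ r) (w′ ℕ.^ suc r) ⟩
    t ℕ.* (t ℕ.^ r ℕ.* w′ ℕ.^ suc r)  ∎)
  coprime-vt : Coprime v t
  coprime-vt (e∣v , e∣t) = coprime-uv (∣-trans e∣t (ℕG.gcd[m,n]∣m u w) , e∣v)
  v≡w′^r+1 : v ≡ w′ ℕ.^ suc r
  v≡w′^r+1 = ℕD.∣-antisym
    (coprime-divisor (Cop.sym (coprime-^ˡ (Cop.sym coprime-vt) r)) (divides u′ (sym u′v≡t^r*w′^r+1)))
    (coprime-divisor (coprime-^ˡ (Cop.sym (Cop.coprime-/gcd u w)) (suc r))
                     (divides (t ℕ.^ r) u′v≡t^r*w′^r+1))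
  instance
    w′^r+1≢0 : NonZero (w′ ℕ.^ suc r)
    w′^r+1≢0 = ℕP.m^n≢0 w′ (suc r) {{ℕ.≢-nonZero w′≢0}}
      where
      w′≢0 : w′ ≢ 0
      w′≢0 w′≡0 = w≢0 (trans (sym t*w′≡w) (trans (cong (t ℕ.*_) w′≡0) (ℕP.*-zeroʳ t)))
  u′≡t^r : u′ ≡ t ℕ.^ r
  u′≡t^r = ℕP.*-cancelʳ-≡ u′ (t ℕ.^ r) (w′ ℕ.^ suc r)
             (trans (cong (u′ ℕ.*_) (sym v≡w′^r+1)) u′v≡t^r*w′^r+1)

neg-^-odd : ∀ x r → (- x) ^ suc (2 ℕ.* r) ≡ - (x ^ suc (2 ℕ.* r))
neg-^-odd x r = trans (cong ((- x) *_) even-power) (sym (ℤP.neg-distribˡ-* x (x ^ (2 ℕ.* r))))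
  where
  square : ∀ x → (- x) * ((- x) * 1ℤ) ≡ x * (x * 1ℤ)
  square = solve-∀
  even-power : (- x) ^ (2 ℕ.* r) ≡ x ^ (2 ℕ.* r)
  even-power = trans (sym (ℤP.^-*-assoc (- x) 2 r)) (trans (cong (_^ r) (square x)) (ℤP.^-*-assoc x 2 r))

odd-root : ∀ r {B t} → ∣ B ∣ ≡ t ℕ.^ suc (2 ℕ.* r) → ∃[ Z₁ ] B ≡ Z₁ ^ suc (2 ℕ.* r)
odd-root r {+ n}      {t} e = + t , trans (cong +_ e) (pos-^ t (suc (2 ℕ.* r)))
odd-root r {ℤ.-[1+ n ]} {t} e = - + t ,
  trans (cong (λ s → - + s) e) (trans (cong -_ (pos-^ t (suc (2 ℕ.* r)))) (sym (neg-^-odd (+ t) r)))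

Even : ℤ → Set
Even x = ∃[ q ] x ≡ + 2 * q

infix 4 _≡1mod_

_≡1mod_ : ℤ → ℤ → Set
x ≡1mod m = ∃[ q ] x ≡ 1ℤ + m * q

Odd : ℤ → Set
Odd x = x ≡1mod + 2

even-or-odd : ∀ x → Even x ⊎ Odd x
even-or-odd x with x ℤDM.%ℕ 2 | ℤDM.n%ℕd<d x 2 | ℤDM.a≡a%ℕn+[a/ℕn]*n x 2
... | 0           | _              | x≡ = inj₁ (x ℤDM./ℕ 2 , trans x≡ (remainder-0 (x ℤDM./ℕ 2)))
  where
  remainder-0 : ∀ q → + 0 + q * + 2 ≡ + 2 * q
  remainder-0 = solve-∀
... | 1           | _              | x≡ = inj₂ (x ℤDM./ℕ 2 , trans x≡ (remainder-1 (x ℤDM./ℕ 2)))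
  where
  remainder-1 : ∀ q → + 1 + q * + 2 ≡ 1ℤ + + 2 * q
  remainder-1 = solve-∀
... | suc (suc _) | s≤s (s≤s ())   | _

even⇒¬odd : ∀ {x} → Even x → ¬ Odd x
even⇒¬odd {x} (p , x≡2p) (q , x≡1+2q) =
  ℕP.even≢odd ∣ p - q ∣ 0 (sym (trans (cong ∣_∣ 1≡2[p-q]) (ℤP.abs-* (+ 2) (p - q))))
  where
  open ≡-Reasoning
  cancel : ∀ q → 1ℤ ≡ 1ℤ + + 2 * q - + 2 * q
  cancel = solve-∀
  factor : ∀ p q → + 2 * p - + 2 * q ≡ + 2 * (p - q)
  factor = solve-∀
  1≡2[p-q] : 1ℤ ≡ + 2 * (p - q)
  1≡2[p-q] = begin
    1ℤ                     ≡⟨ cancel q ⟩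
    1ℤ + + 2 * q - + 2 * q ≡⟨ cong (_- + 2 * q) (trans (sym x≡1+2q) x≡2p) ⟩
    + 2 * p - + 2 * q      ≡⟨ factor p q ⟩
    + 2 * (p - q)          ∎

even⇒2∣ : ∀ {x} → Even x → 2 ∣ ∣ x ∣
even⇒2∣ {x} (q , x≡2q) = ℤD.∣⇒∣ᵤ (ℤD.divides q (trans x≡2q (ℤP.*-comm (+ 2) q)))

odd⇒¬2∣ : ∀ {x} → Odd x → ¬ 2 ∣ ∣ x ∣
odd⇒¬2∣ {x} odd 2∣x with ℤD.∣ᵤ⇒∣ {+ 2} {x} 2∣x
... | ℤD.divides q x≡2q = even⇒¬odd (q , trans x≡2q (ℤP.*-comm q (+ 2))) odd

≡1mod-* : ∀ m {x y} → x ≡1mod m → y ≡1mod m → (x * y) ≡1mod m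
≡1mod-* m (a , x≡) (b , y≡) = a + b + m * a * b , trans (cong₂ _*_ x≡ y≡) (expand m a b)
  where
  expand : ∀ m a b → (1ℤ + m * a) * (1ℤ + m * b) ≡ 1ℤ + m * (a + b + m * a * b)
  expand = solve-∀

≡1mod-^ : ∀ m {x} → x ≡1mod m → ∀ j → (x ^ j) ≡1mod m
≡1mod-^ m _ zero    = + 0 , sym (cong (λ y → 1ℤ + y) (ℤP.*-zeroʳ m))
≡1mod-^ m h (suc j) = ≡1mod-* m h (≡1mod-^ m h j)

odd-^-even : ∀ {x} → Odd x → ∀ t → (x ^ (2 ℕ.* t)) ≡1mod + 4
odd-^-even {x} (a , x≡1+2a) t = subst (_≡1mod + 4) (ℤP.^-*-assoc x 2 t) (≡1mod-^ (+ 4) square t)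
  where
  expand : ∀ a → (1ℤ + + 2 * a) * ((1ℤ + + 2 * a) * 1ℤ) ≡ 1ℤ + + 4 * (a + a * a)
  expand = solve-∀
  square : (x ^ 2) ≡1mod + 4
  square = a + a * a , trans (cong (λ y → y * (y * 1ℤ)) x≡1+2a) (expand a)

even-^ : ∀ {x} → Even x → ∀ j → Even (x ^ suc j)
even-^ {x} (a , x≡2a) j = a * x ^ j , trans (cong (_* x ^ j) x≡2a) (ℤP.*-assoc (+ 2) a (x ^ j))

even+odd : ∀ {x y} → Even x → Odd y → Odd (x + y)
even+odd (a , x≡2a) (b , y≡1+2b) = a + b , trans (cong₂ _+_ x≡2a y≡1+2b) (regroup a b)
  where
  regroup : ∀ a b → + 2 * a + (1ℤ + + 2 * b) ≡ 1ℤ + + 2 * (a + b)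
  regroup = solve-∀

geometric-odd : ∀ {a b} → Odd a → Odd b → ∀ j → ∃[ q ] geometric j a b ≡ + j + + 2 * q
geometric-odd oa ob zero = + 0 , refl
geometric-odd {a} {b} oa (u , b≡) (suc j) with ≡1mod-^ (+ 2) oa j | geometric-odd oa (u , b≡) j
... | (p , a^j≡) | (q , G≡) = p + u * + j + q + + 2 * u * q ,
  trans (cong₂ _+_ a^j≡ (cong₂ _*_ b≡ G≡)) (expand p u (+ j) q)
  where
  expand : ∀ p u J q → 1ℤ + + 2 * p + (1ℤ + + 2 * u) * (J + + 2 * q) ≡
                       1ℤ + J + + 2 * (p + u * J + q + + 2 * u * q)
  expand = solve-∀

geometric-odd-length : ∀ {a b h} → Odd a → Odd b → ∀ j → j ≡ 1 ℕ.+ h ℕ.* 2 → Odd (geometric j a b)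
geometric-odd-length {a} {b} {h} oa ob j j≡1+2h with geometric-odd oa ob j
... | q , G≡ = + h + q , (begin
  geometric j a b                ≡⟨ G≡ ⟩
  + j + + 2 * q                  ≡⟨ cong (λ s → + s + + 2 * q) j≡1+2h ⟩
  + (1 ℕ.+ h ℕ.* 2) + + 2 * q    ≡⟨ cong (λ s → s + + 2 * q) (ℤP.pos-+ 1 (h ℕ.* 2)) ⟩
  1ℤ + + (h ℕ.* 2) + + 2 * q     ≡⟨ cong (λ s → 1ℤ + s + + 2 * q) (ℤP.pos-* h 2) ⟩
  1ℤ + + h * + 2 + + 2 * q       ≡⟨ regroup (+ h) q ⟩
  1ℤ + + 2 * (+ h + q)           ∎)
  where
  open ≡-Reasoning
  regroup : ∀ h q → 1ℤ + h * + 2 + + 2 * q ≡ 1ℤ + + 2 * (h + q)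
  regroup = solve-∀

divisors-of-2 : ∀ {e} → e ∣ 2 → e ≡ 1 ⊎ e ≡ 2
divisors-of-2 {zero}                e∣2 = ⊥-elim (ℕP.1+n≢0 (ℕD.0∣⇒≡0 e∣2))
divisors-of-2 {suc zero}            e∣2 = inj₁ refl
divisors-of-2 {suc (suc zero)}      e∣2 = inj₂ refl
divisors-of-2 {suc (suc (suc _))}   e∣2 with ℕD.∣⇒≤ e∣2
... | s≤s (s≤s ())

coprime-if-odd : ∀ {u v} → ¬ 2 ∣ u → (∀ {e} → e ∣ u → e ∣ v → e ∣ 2) → Coprime u v
coprime-if-odd 2∤u common∣2 (e∣u , e∣v) with divisors-of-2 (common∣2 e∣u e∣v)
... | inj₁ e≡1 = e≡1
... | inj₂ refl = ⊥-elim (2∤u e∣u)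

module PeriodTwo (r : ℕ) {X₁ X₂ Z : ℤ} (Z≢0 : ∣ Z ∣ ≢ 0) (X₁≢X₂ : X₁ ≢ X₂)
  (coprime-X₁X₂ : Coprime ∣ X₁ ∣ ∣ X₂ ∣) (coprime-X₁Z : Coprime ∣ X₁ ∣ ∣ Z ∣)
  (equation : (X₁ - X₂) * Z ^ (2 ℕ.* suc r ∸ 1) ≡ X₂ ^ (2 ℕ.* suc r) - X₁ ^ (2 ℕ.* suc r)) where

  k m : ℕ
  k = suc r
  m = 2 ℕ.* k ∸ 1

  m≡1+2r : m ≡ suc (2 ℕ.* r)
  m≡1+2r = ℕP.+-suc r (r ℕ.+ 0)

  A B : ℤ
  A = geometric k X₂ X₁
  B = X₁ ^ k + X₂ ^ k

  Z^m≡-AB : Z ^ m ≡ - (A * B)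
  Z^m≡-AB = ℤP.*-cancelˡ-≡ (X₁ - X₂) (Z ^ m) (- (A * B))
    {{ℤ.≢-nonZero (λ X₁-X₂≡0 → X₁≢X₂ (ℤP.i-j≡0⇒i≡j X₁ X₂ X₁-X₂≡0))}} (begin
    (X₁ - X₂) * Z ^ m                         ≡⟨ equation ⟩
    X₂ ^ (2 ℕ.* k) - X₁ ^ (2 ℕ.* k)           ≡⟨ cong₂ _-_ (square X₂) (square X₁) ⟩
    X₂ ^ k * X₂ ^ k - X₁ ^ k * X₁ ^ k         ≡⟨ difference-of-squares (X₁ ^ k) (X₂ ^ k) ⟩
    (X₂ ^ k - X₁ ^ k) * (X₂ ^ k + X₁ ^ k)     ≡⟨ cong (_* (X₂ ^ k + X₁ ^ k)) (^-difference k X₂ X₁) ⟩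
    (X₂ - X₁) * A * (X₂ ^ k + X₁ ^ k)         ≡⟨ regroup X₁ X₂ A (X₁ ^ k) (X₂ ^ k) ⟩
    (X₁ - X₂) * - (A * B)                     ∎)
    where
    open ≡-Reasoning
    square : ∀ X → X ^ (2 ℕ.* k) ≡ X ^ k * X ^ k
    square X = trans (ℤP.^-distribˡ-+-* X k (k ℕ.+ 0)) (cong (λ t → X ^ k * X ^ t) (ℕP.+-identityʳ k))
    difference-of-squares : ∀ P Q → Q * Q - P * P ≡ (Q - P) * (Q + P)
    difference-of-squares = solve-∀
    regroup : ∀ x₁ x₂ a P Q → (x₂ - x₁) * a * (Q + P) ≡ (x₁ - x₂) * - (a * (P + Q))
    regroup = solve-∀

  ∣A∣*∣B∣≡∣Z∣^m : ∣ A ∣ ℕ.* ∣ B ∣ ≡ ∣ Z ∣ ℕ.^ m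
  ∣A∣*∣B∣≡∣Z∣^m = begin
    ∣ A ∣ ℕ.* ∣ B ∣    ≡⟨ sym (ℤP.abs-* A B) ⟩
    ∣ A * B ∣          ≡⟨ sym (ℤP.∣-i∣≡∣i∣ (A * B)) ⟩
    ∣ - (A * B) ∣      ≡⟨ cong ∣_∣ (sym Z^m≡-AB) ⟩
    ∣ Z ^ m ∣          ≡⟨ ∣^∣ Z m ⟩
    ∣ Z ∣ ℕ.^ m        ∎
    where open ≡-Reasoning

  -- a common divisor of A and B divides B - (X₂ ^ k - X₁ ^ k) = 2 X₁ ^ k and is coprime to X₁
  common-divisor∣2 : ∀ {e} → e ∣ ∣ A ∣ → e ∣ ∣ B ∣ → e ∣ 2
  common-divisor∣2 {e} e∣A e∣B = coprime-divisor coprime-eX₁^k e∣X₁^k*2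
    where
    twice : ∀ P Q → (P + Q) - (Q - P) ≡ P * + 2
    twice = solve-∀
    e∣X₂^k-X₁^k : + e ℤD.∣ (X₂ ^ k - X₁ ^ k)
    e∣X₂^k-X₁^k = subst (+ e ℤD.∣_) (sym (^-difference k X₂ X₁))
                        (ℤD.∣n⇒∣m*n (X₂ - X₁) (ℤD.∣ᵤ⇒∣ {+ e} {A} e∣A))
    e∣X₁^k*2 : e ∣ ∣ X₁ ∣ ℕ.^ k ℕ.* 2
    e∣X₁^k*2 = subst (e ∣_) (trans (ℤP.abs-* (X₁ ^ k) (+ 2)) (cong (ℕ._* 2) (∣^∣ X₁ k)))
      (ℤD.∣⇒∣ᵤ (subst (+ e ℤD.∣_) (twice (X₁ ^ k) (X₂ ^ k))
                     (ℤD.∣m∣n⇒∣m-n (ℤD.∣ᵤ⇒∣ {+ e} {B} e∣B) e∣X₂^k-X₁^k)))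
    e∣Z^m : e ∣ ∣ Z ∣ ℕ.^ m
    e∣Z^m = ∣-trans e∣A (divides ∣ B ∣ (trans (sym ∣A∣*∣B∣≡∣Z∣^m) (ℕP.*-comm ∣ A ∣ ∣ B ∣)))
    coprime-eX₁^k : Coprime e (∣ X₁ ∣ ℕ.^ k)
    coprime-eX₁^k (d∣e , d∣X₁^k) =
      coprime-^ˡ (Cop.sym (coprime-^ˡ (Cop.sym coprime-X₁Z) m)) k (d∣X₁^k , ∣-trans d∣e e∣Z^m)

  power-if-coprime-cofactor : ∀ U {v} → Coprime ∣ U ∣ v → ∣ U ∣ ℕ.* v ≡ ∣ Z ∣ ℕ.^ m → ∃[ Z₁ ] U ≡ Z₁ ^ m
  power-if-coprime-cofactor U coprime U*v≡Z^m
    with coprime-factor-of-power (2 ℕ.* r) Z≢0 coprime (trans U*v≡Z^m (cong (∣ Z ∣ ℕ.^_) m≡1+2r))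
  ... | t , ∣U∣≡t^m with odd-root r {t = t} ∣U∣≡t^m
  ... | Z₁ , U≡Z₁^m = Z₁ , trans U≡Z₁^m (cong (Z₁ ^_) (sym m≡1+2r))

  power-if-odd-factor : Odd A ⊎ Odd B → ∃[ Z₁ ] B ≡ Z₁ ^ m
  power-if-odd-factor oddA⊎oddB =
    power-if-coprime-cofactor B (coprime-BA oddA⊎oddB) (trans (ℕP.*-comm ∣ B ∣ ∣ A ∣) ∣A∣*∣B∣≡∣Z∣^m)
    where
    coprime-BA : Odd A ⊎ Odd B → Coprime ∣ B ∣ ∣ A ∣
    coprime-BA (inj₁ oddA) = Cop.sym (coprime-if-odd (odd⇒¬2∣ oddA) common-divisor∣2)
    coprime-BA (inj₂ oddB) = coprime-if-odd (odd⇒¬2∣ oddB) (λ e∣B e∣A → common-divisor∣2 e∣A e∣B)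

  -- for odd X₁, X₂ and even k, B ≡ 2 mod 4, so B / 2 is odd and coprime to 2 A
  half-power-if-both-odd : Odd X₁ → Odd X₂ → ∀ h → k ≡ h ℕ.* 2 → ∃[ Z₁ ] B ≡ + 2 * Z₁ ^ m
  half-power-if-both-odd odd₁ odd₂ h k≡2h =
    map₂ (λ B′≡Z₁^m → trans B≡2B′ (cong (+ 2 *_) B′≡Z₁^m))
         (power-if-coprime-cofactor B′ coprime-B′-2A B′*2A≡Z^m)
    where
    X^k≡1mod4 : ∀ {X} → Odd X → X ^ k ≡1mod + 4
    X^k≡1mod4 {X} oddX = subst (λ j → X ^ j ≡1mod + 4) (trans (ℕP.*-comm 2 h) (sym k≡2h)) (odd-^-even oddX h)
    a₁ a₂ : ℤ
    a₁ = proj₁ (X^k≡1mod4 odd₁)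
    a₂ = proj₁ (X^k≡1mod4 odd₂)
    B′ : ℤ
    B′ = 1ℤ + + 2 * (a₁ + a₂)
    halve : ∀ a b → 1ℤ + + 4 * a + (1ℤ + + 4 * b) ≡ + 2 * (1ℤ + + 2 * (a + b))
    halve = solve-∀
    B≡2B′ : B ≡ + 2 * B′
    B≡2B′ = trans (cong₂ _+_ (proj₂ (X^k≡1mod4 odd₁)) (proj₂ (X^k≡1mod4 odd₂))) (halve a₁ a₂)
    ∣B∣≡2∣B′∣ : ∣ B ∣ ≡ 2 ℕ.* ∣ B′ ∣
    ∣B∣≡2∣B′∣ = trans (cong ∣_∣ B≡2B′) (ℤP.abs-* (+ 2) B′)
    2∤B′ : ¬ 2 ∣ ∣ B′ ∣
    2∤B′ = odd⇒¬2∣ (a₁ + a₂ , refl)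
    coprime-B′-2A : Coprime ∣ B′ ∣ (2 ℕ.* ∣ A ∣)
    coprime-B′-2A = Cop.sym (coprime-*ˡ (Cop.sym (coprime-if-odd 2∤B′ (λ _ e∣2 → e∣2)))
      (Cop.sym (coprime-if-odd 2∤B′ (λ e∣B′ e∣A → common-divisor∣2 e∣A (∣-trans e∣B′ (divides 2 ∣B∣≡2∣B′∣))))))
    B′*2A≡Z^m : ∣ B′ ∣ ℕ.* (2 ℕ.* ∣ A ∣) ≡ ∣ Z ∣ ℕ.^ m
    B′*2A≡Z^m = trans (CommSemigroupProperties.x∙yz≈z∙yx ℕP.*-commutativeSemigroup (∣ B′ ∣) 2 (∣ A ∣))
                      (trans (cong (∣ A ∣ ℕ.*_) (sym ∣B∣≡2∣B′∣)) ∣A∣*∣B∣≡∣Z∣^m)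

  sum-of-powers-both-odd : Odd X₁ → Odd X₂ → (∃[ Z₁ ] B ≡ Z₁ ^ m) ⊎ (k % 2 ≡ 0 × ∃[ Z₁ ] B ≡ + 2 * Z₁ ^ m)
  sum-of-powers-both-odd odd₁ odd₂ with k % 2 | ℕDM.m%n<n k 2 | ℕDM.m≡m%n+[m/n]*n k 2
  ... | 0           | _            | k≡2h   = inj₂ (refl , half-power-if-both-odd odd₁ odd₂ (k ℕDM./ 2) k≡2h)
  ... | 1           | _            | k≡1+2h =
    inj₁ (power-if-odd-factor (inj₁ (geometric-odd-length {h = k ℕDM./ 2} odd₂ odd₁ k k≡1+2h)))
  ... | suc (suc _) | s≤s (s≤s ()) | _

  sum-of-powers : (∃[ Z₁ ] B ≡ Z₁ ^ m) ⊎ (k % 2 ≡ 0 × ∃[ Z₁ ] B ≡ + 2 * Z₁ ^ m)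
  sum-of-powers with even-or-odd X₁ | even-or-odd X₂
  ... | inj₁ even₁ | inj₁ even₂ = contradiction (coprime-X₁X₂ (even⇒2∣ even₁ , even⇒2∣ even₂)) λ ()
  ... | inj₁ even₁ | inj₂ odd₂  =
    inj₁ (power-if-odd-factor (inj₂ (even+odd (even-^ even₁ r) (≡1mod-^ (+ 2) odd₂ k))))
  ... | inj₂ odd₁  | inj₁ even₂ =
    inj₁ (power-if-odd-factor (inj₂ (subst Odd (ℤP.+-comm (X₂ ^ k) (X₁ ^ k))
                                           (even+odd (even-^ even₂ r) (≡1mod-^ (+ 2) odd₁ k)))))
  ... | inj₂ odd₁  | inj₂ odd₂  = sum-of-powers-both-odd odd₁ odd₂

δ-power-form : ∀ {k m B} → (∃[ Z₁ ] B ≡ Z₁ ^ m) ⊎ (k % 2 ≡ 0 × ∃[ Z₁ ] B ≡ + 2 * Z₁ ^ m) →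
               (∃[ Z₁ ] ∃[ δ ] ((δ ≡ 1ℤ ⊎ δ ≡ + 2) × (B ≡ δ * Z₁ ^ m))) × (k % 2 ≡ 1 → ∃[ Z₁ ] (B ≡ Z₁ ^ m))
δ-power-form {m = m} (inj₁ (Z₁ , B≡Z₁^m)) =
  (Z₁ , 1ℤ , inj₁ refl , trans B≡Z₁^m (sym (ℤP.*-identityˡ (Z₁ ^ m)))) , λ _ → Z₁ , B≡Z₁^m
δ-power-form (inj₂ (k-even , Z₁ , B≡2Z₁^m)) =
  (Z₁ , + 2 , inj₂ refl , B≡2Z₁^m) , λ k-odd → contradiction (trans (sym k-even) k-odd) λ ()

theorem3p3 : (k n : ℕ) → 1 ≤ k → 1 < n → (c : ℚ) → (X₁ X₂ C Z : ℤ) → (x₁ x₂ : ℚ)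
    → ↥ x₁ ≡ X₁ → ↧ x₁ ≡ Z
    → ↥ x₂ ≡ X₂ → ↧ x₂ ≡ Z
    → ↥ c ≡ C → ↧ c ≡ Z ^ (2 *ℕ k)
    → x₂ ≡ f (2 *ℕ k) c x₁
    → ExactPeriod (f (2 *ℕ k) c) n x₁
    → ExactPeriod (f (2 *ℕ k) c) n x₂
    → (gcd X₁ X₂ ≡ 1ℤ)
      × (n ≡ 2
         → (∃[ Z₁ ] ∃[ δ ] ((δ ≡ 1ℤ ⊎ δ ≡ + 2) × (X₁ ^ k + X₂ ^ k ≡ δ * Z₁ ^ (2 *ℕ k ∸ 1))))
           × (k % 2 ≡ 1 → ∃[ Z₁ ] (X₁ ^ k + X₂ ^ k ≡ Z₁ ^ (2 *ℕ k ∸ 1))))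
theorem3p3 zero n () c X₁ X₂ C Z x₁ x₂ ↥x₁ ↧x₁ ↥x₂ ↧x₂ ↥c ↧c x₂≡fx₁ period₁ period₂
theorem3p3 (suc r) n _ 1<n c X₁ X₂ C Z x₁ x₂ ↥x₁ ↧x₁ ↥x₂ ↧x₂ _ _ x₂≡fx₁ (periodic , aperiodic) _ =
  gcd≡1 , λ n≡2 → δ-power-form {suc r} {2 ℕ.* suc r ∸ 1}
    (PeriodTwo.sum-of-powers r Z≢0 X₁≢X₂ coprime-X₁X₂ (↥↧-coprime x₁ ↥x₁ ↧x₁) (equation n≡2))
  where
  F : ℚ → ℚ
  F = f (2 ℕ.* suc r) c
  X₁≢X₂ : X₁ ≢ X₂
  X₁≢X₂ X₁≡X₂ = aperiodic 1 (s≤s z≤n) 1<n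
    (trans (sym x₂≡fx₁) (common-denominator-injective ↥x₂ ↧x₂ ↥x₁ ↧x₁ (sym X₁≡X₂)))
  gcd≡1 : gcd X₁ X₂ ≡ 1ℤ
  gcd≡1 = periodic-numerators-coprime (ℕP.*-monoʳ-≤ 2 (s≤s (z≤n {r}))) (ℕP.<-trans (s≤s z≤n) 1<n)
            ↥x₁ ↧x₁ ↥x₂ ↧x₂ x₂≡fx₁ periodic X₁≢X₂
  coprime-X₁X₂ : Coprime ∣ X₁ ∣ ∣ X₂ ∣
  coprime-X₁X₂ = Cop.gcd≡1⇒coprime (cong ∣_∣ gcd≡1)
  Z≢0 : ∣ Z ∣ ≢ 0
  Z≢0 ∣Z∣≡0 = ℕP.1+n≢0 (trans (cong ∣_∣ ↧x₁) ∣Z∣≡0)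
  equation : n ≡ 2 → (X₁ - X₂) * Z ^ (2 ℕ.* suc r ∸ 1) ≡ X₂ ^ (2 ℕ.* suc r) - X₁ ^ (2 ℕ.* suc r)
  equation n≡2 = period-two-numerators {m = 2 ℕ.* suc r ∸ 1}
    (*-denominator x₁ ↥x₁ ↧x₁) (*-denominator x₂ ↥x₂ ↧x₂) (sym x₂≡fx₁)
    (trans (cong F x₂≡fx₁) (subst (λ j → iterate F j x₁ ≡ x₁) n≡2 periodic))
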